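{- Let $\overrightarrow{F}$ be the antidirected path on $4$ vertices, i.e. the path $a,b,c,d$ with arcs $\overrightarrow{ab},\overrightarrow{cb},\overrightarrow{cd}$. Then for every $n>1$, $\mathrm{ex}_{\mathrm{ori}}(n,\overrightarrow{F})=2n-3$.
   Context: An oriented graph is a directed graph with no loops, no multiple arcs and no pair of opposite arcs. $\mathrm{ex}_{\mathrm{ori}}(n,\overrightarrow{F})$ is the largest number of arcs in an $n$-vertex oriented graph not containing $\overrightarrow{F}$ as a (not necessarily induced) subgraph. An oriented graph is antidirected if every vertex is a source or a sink. -}

module Defs where

open import Data.Nat using (ℕ; zero; suc; _+_; _*_; _∸_; _≤_)
open import Data.Bool using (Bool; true; false; T; if_then_else_)
open import Data.Fin using (Fin)
open import Data.List using (List; map)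
open import Data.Nat.ListAction using (sum)
open import Data.List.Base using (allFin)
open import Data.Product using (_×_; ∃-syntax; Σ-syntax)
open import Relation.Nullary using (¬_)
open import Relation.Binary.PropositionalEquality using (_≡_; _≢_)

record Digraph (n : ℕ) : Set where
  field
    arc : Fin n → Fin n → Bool

open Digraph public

-- Oriented graph: no loops, no pair of opposite arcs
-- (no multiple arcs is automatic for a relation-based arc set).
record IsOriented {n : ℕ} (G : Digraph n) : Set where
  field
    noLoop     : ∀ i → ¬ T (arc G i i)
    noOpposite : ∀ i j → T (arc G i j) → ¬ T (arc G j i)

numArcs : {n : ℕ} → Digraph n → ℕ
numArcs {n} G =
  sum (map (λ i → sum (map (λ j → if arc G i j then 1 else 0) (allFin n))) (allFin n))

ContainsAP4 : {n : ℕ} → Digraph n → Set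
ContainsAP4 {n} G =
  ∃[ a ] ∃[ b ] ∃[ c ] ∃[ d ]
    ( (a ≢ b) × (a ≢ c) × (a ≢ d) × (b ≢ c) × (b ≢ d) × (c ≢ d)
    × T (arc G a b) × T (arc G c b) × T (arc G c d) )

IsExOriAP4 : ℕ → ℕ → Set
IsExOriAP4 n m =
  (∃[ G ] (IsOriented {n} G × ¬ ContainsAP4 G × numArcs G ≡ m))
  × (∀ (G : Digraph n) → IsOriented G → ¬ ContainsAP4 G → numArcs G ≤ m)

-- Call a vertex big if its out-degree is at least 2, and charge every arc leaving a big
-- vertex to its head and every other arc to its tail, so that the number of arcs is the sum
-- of the resulting vertex weights. If j had two big in-neighbours c and c', an out-neighbour
-- d ≠ j of c would give the path c' → j ← c → d unless d = c'; so c → c', and symmetrically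
-- c' → c, which is impossible. Hence every weight is at most 2, and at most 1 at a big vertex.
-- It remains to find a deficit ∑ (2 − weight) ≥ 3: without big vertices all weights are at
-- most 1; a big vertex c with a big in-neighbour p gives two or three light vertices along
-- big in-neighbours; and if c has none, either another vertex is light or c dominates a
-- graph whose other vertices have out-degree 1, and such a graph contains the path.
-- The lower bound is attained by 0 → 1, 1 → k and k → 0 for all k ≥ 2.
module Submission where

open import Defs
open import Data.Nat using (ℕ; zero; suc; _+_; _*_; _∸_; _≤_; _<_; z≤n; s≤s; s≤s⁻¹; _≤?_; _<?_)
open import Data.Nat.Properties
open import Data.Nat.ListAction as ℕᴸ using ()
open import Data.Bool using (Bool; true; false; T; if_then_else_)
open import Data.Bool.Properties using (if-cong)
open import Data.Fin using (Fin; zero; suc; punchIn; punchOut) renaming (_≟_ to _≟ᶠ_)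
open import Data.Fin.Properties
  using (any?; punchInᵢ≢i; punchIn-punchOut; punchOut-injective)
import Data.Fin.Properties as Finₚ
open import Data.List using (map; tabulate; allFin)
open import Data.List.Properties using (map-tabulate)
open import Data.Vec.Functional using (removeAt)
open import Data.Product using (_×_; _,_; proj₁; proj₂; ∃-syntax)
open import Data.Unit using (tt)
open import Data.Empty using (⊥; ⊥-elim)
open import Function using (_∘_; id)
open import Relation.Nullary using (¬_; Dec; yes; no; does; contradiction)
open import Relation.Nullary.Decidable using (dec-true; dec-false; ¬?; _×-dec_)
open import Relation.Binary.PropositionalEquality
open import Algebra.Properties.CommutativeMonoid.Sum +-0-commutativeMonoid
  using (sum; sum-syntax; sum-cong-≗; ∑-distrib-+; ∑-comm; sum-remove)

open ≤-Reasoning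

∑-const : ∀ n c → ∑[ i < n ] c ≡ n * c
∑-const zero    c = refl
∑-const (suc n) c = cong (c +_) (∑-const n c)

∑-zero : ∀ n → ∑[ i < n ] 0 ≡ 0
∑-zero n = trans (∑-const n 0) (*-zeroʳ n)

sumᴸ-map-allFin : ∀ {n} (f : Fin n → ℕ) → ℕᴸ.sum (map f (allFin n)) ≡ sum f
sumᴸ-map-allFin f = trans (cong ℕᴸ.sum (map-tabulate id f)) (sumᴸ-tabulate f)
  where
  sumᴸ-tabulate : ∀ {n} (f : Fin n → ℕ) → ℕᴸ.sum (tabulate f) ≡ sum f
  sumᴸ-tabulate {zero}  f = refl
  sumᴸ-tabulate {suc n} f = cong (f zero +_) (sumᴸ-tabulate (f ∘ suc))

∑-mono-≤ : ∀ {n} {f g : Fin n → ℕ} → (∀ i → f i ≤ g i) → sum f ≤ sum g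
∑-mono-≤ {zero}  f≤g = z≤n
∑-mono-≤ {suc n} f≤g = +-mono-≤ (f≤g zero) (∑-mono-≤ (f≤g ∘ suc))

≤-∑ : ∀ {n} (f : Fin n → ℕ) i → f i ≤ sum f
≤-∑ {suc n} f i = begin
  f i                         ≤⟨ m≤m+n (f i) _ ⟩
  f i + sum (removeAt f i)    ≡⟨ sum-remove f ⟨
  sum f                       ∎

pair-≤-∑ : ∀ {n} (f : Fin n → ℕ) {i j} → i ≢ j → f i + f j ≤ sum f
pair-≤-∑ {suc n} f {i} {j} i≢j = begin
  f i + f j                                ≡⟨ cong (λ k → f i + f k) (punchIn-punchOut i≢j) ⟨
  f i + removeAt f i (punchOut i≢j)        ≤⟨ +-monoʳ-≤ (f i) (≤-∑ (removeAt f i) _) ⟩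
  f i + sum (removeAt f i)                 ≡⟨ sum-remove f ⟨
  sum f                                    ∎

triple-≤-∑ : ∀ {n} (f : Fin n → ℕ) {i j k} → i ≢ j → i ≢ k → j ≢ k → f i + f j + f k ≤ sum f
triple-≤-∑ {suc n} f {i} {j} {k} i≢j i≢k j≢k = begin
  f i + f j + f k                          ≡⟨ +-assoc (f i) (f j) (f k) ⟩
  f i + (f j + f k)                        ≡⟨ cong₂ (λ x y → f i + (f x + f y))
                                                (punchIn-punchOut i≢j) (punchIn-punchOut i≢k) ⟨
  f i + (removeAt f i (punchOut i≢j) + removeAt f i (punchOut i≢k))
    ≤⟨ +-monoʳ-≤ (f i) (pair-≤-∑ (removeAt f i) (j≢k ∘ punchOut-injective i≢j i≢k)) ⟩
  f i + sum (removeAt f i)                 ≡⟨ sum-remove f ⟨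
  sum f                                    ∎

≯0⇒≡0 : ∀ {m} → ¬ 0 < m → m ≡ 0
≯0⇒≡0 m≯0 = n≤0⇒n≡0 (≮⇒≥ m≯0)

∑-pos⇒∃-pos : ∀ {n} (f : Fin n → ℕ) → 0 < sum f → ∃[ i ] 0 < f i
∑-pos⇒∃-pos {suc n} f ∑>0 with 0 <? f zero
... | yes f₀>0 = zero , f₀>0
... | no  f₀≯0 with ∑-pos⇒∃-pos (f ∘ suc) (subst (λ x → 0 < x + sum (f ∘ suc)) (≯0⇒≡0 f₀≯0) ∑>0)
...   | i , fᵢ>0 = suc i , fᵢ>0

∑-≤1 : ∀ {n} (f : Fin n → ℕ) → (∀ i → f i ≤ 1) →
       (∀ i j → 0 < f i → 0 < f j → i ≡ j) → sum f ≤ 1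
∑-≤1 {zero}  f f≤1 unique = z≤n
∑-≤1 {suc n} f f≤1 unique with 0 <? f zero
... | yes f₀>0 = begin
  f zero + sum (f ∘ suc)   ≡⟨ cong (f zero +_) (trans (sum-cong-≗ rest≡0) (∑-zero n)) ⟩
  f zero + 0               ≡⟨ +-identityʳ (f zero) ⟩
  f zero                   ≤⟨ f≤1 zero ⟩
  1                        ∎
  where
  rest≡0 : ∀ i → f (suc i) ≡ 0
  rest≡0 i = ≯0⇒≡0 (Finₚ.0≢1+n ∘ unique zero (suc i) f₀>0)
... | no  f₀≯0 = begin
  f zero + sum (f ∘ suc)   ≡⟨ cong (_+ sum (f ∘ suc)) (≯0⇒≡0 f₀≯0) ⟩
  sum (f ∘ suc)            ≤⟨ ∑-≤1 (f ∘ suc) (f≤1 ∘ suc) unique-suc ⟩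
  1                        ∎
  where
  unique-suc : ∀ i j → 0 < f (suc i) → 0 < f (suc j) → i ≡ j
  unique-suc i j fᵢ>0 fⱼ>0 = Finₚ.suc-injective (unique (suc i) (suc j) fᵢ>0 fⱼ>0)

∃-other-pos : ∀ {n} (f : Fin n → ℕ) → (∀ i → f i ≤ 1) → 2 ≤ sum f →
              ∀ j → ∃[ k ] k ≢ j × 0 < f k
∃-other-pos {suc n} f f≤1 ∑≥2 j with ∑-pos⇒∃-pos (removeAt f j) rest>0
  where
  rest>0 : 0 < sum (removeAt f j)
  rest>0 = s≤s⁻¹ (begin
    2                          ≤⟨ ∑≥2 ⟩
    sum f                      ≡⟨ sum-remove f ⟩
    f j + sum (removeAt f j)   ≤⟨ +-monoˡ-≤ _ (f≤1 j) ⟩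
    1 + sum (removeAt f j)     ∎)
... | k , pos = punchIn j k , punchInᵢ≢i j k , pos

∑-complement : ∀ {n} k (f : Fin n → ℕ) → (∀ i → f i ≤ k) →
               sum f + ∑[ i < n ] (k ∸ f i) ≡ n * k
∑-complement {n} k f f≤k = begin-equality
  sum f + ∑[ i < n ] (k ∸ f i)   ≡⟨ ∑-distrib-+ f _ ⟨
  ∑[ i < n ] (f i + (k ∸ f i))   ≡⟨ sum-cong-≗ (m+[n∸m]≡n ∘ f≤k) ⟩
  ∑[ i < n ] k                   ≡⟨ ∑-const n k ⟩
  n * k                          ∎

≤1⇒1≤2∸ : ∀ {x} → x ≤ 1 → 1 ≤ 2 ∸ x
≤1⇒1≤2∸ z≤n       = s≤s z≤n
≤1⇒1≤2∸ (s≤s z≤n) = s≤s z≤n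

module _ {n} (w : Fin n → ℕ) where

  slack-all : (∀ v → w v ≤ 1) → n ≤ ∑[ v < n ] (2 ∸ w v)
  slack-all w≤1 = begin
    n                        ≡⟨ trans (∑-const n 1) (*-identityʳ n) ⟨
    ∑[ v < n ] 1             ≤⟨ ∑-mono-≤ (≤1⇒1≤2∸ ∘ w≤1) ⟩
    ∑[ v < n ] (2 ∸ w v)     ∎

  slack-pair : ∀ {u v} → u ≢ v → w u ≡ 0 → w v ≤ 1 → 3 ≤ ∑[ v < n ] (2 ∸ w v)
  slack-pair {u} {v} u≢v wᵤ≡0 wᵥ≤1 = begin
    3                        ≤⟨ +-monoʳ-≤ 2 (≤1⇒1≤2∸ wᵥ≤1) ⟩
    2 + (2 ∸ w v)            ≡⟨ cong (λ x → 2 ∸ x + (2 ∸ w v)) wᵤ≡0 ⟨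
    (2 ∸ w u) + (2 ∸ w v)    ≤⟨ pair-≤-∑ (λ x → 2 ∸ w x) u≢v ⟩
    ∑[ v < n ] (2 ∸ w v)     ∎

  slack-triple : ∀ {u v x} → u ≢ v → u ≢ x → v ≢ x → w u ≤ 1 → w v ≤ 1 → w x ≤ 1 →
                 3 ≤ ∑[ v < n ] (2 ∸ w v)
  slack-triple u≢v u≢x v≢x wᵤ≤1 wᵥ≤1 wₓ≤1 = ≤-trans
    (+-mono-≤ (+-mono-≤ (≤1⇒1≤2∸ wᵤ≤1) (≤1⇒1≤2∸ wᵥ≤1)) (≤1⇒1≤2∸ wₓ≤1))
    (triple-≤-∑ (λ x → 2 ∸ w x) u≢v u≢x v≢x)

  ∑-≤-2n∸3 : (∀ v → w v ≤ 2) → 3 ≤ ∑[ v < n ] (2 ∸ w v) → sum w ≤ 2 * n ∸ 3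
  ∑-≤-2n∸3 w≤2 slack = m+n≤o⇒m≤o∸n (sum w) (begin
    sum w + 3                       ≤⟨ +-monoʳ-≤ (sum w) slack ⟩
    sum w + ∑[ v < n ] (2 ∸ w v)    ≡⟨ ∑-complement 2 w w≤2 ⟩
    n * 2                           ≡⟨ *-comm n 2 ⟩
    2 * n                           ∎)

both-pos : ∀ {a b} → a ≤ 1 → b ≤ 1 → 2 ≤ a + b → 0 < a × 0 < b
both-pos (s≤s z≤n) (s≤s z≤n) _         = s≤s z≤n , s≤s z≤n
both-pos z≤n       z≤n       ()
both-pos z≤n       (s≤s z≤n) (s≤s ())
both-pos (s≤s z≤n) z≤n       (s≤s ())

-- Charging arcs to vertices

𝟙 : Bool → ℕ
𝟙 b = if b then 1 else 0

𝟙≤1 : ∀ b → 𝟙 b ≤ 1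
𝟙≤1 true  = s≤s z≤n
𝟙≤1 false = z≤n

𝟙-pos⇒T : ∀ {b} → 0 < 𝟙 b → T b
𝟙-pos⇒T {true} _ = tt

module _ {n} (G : Digraph n) where

  outdeg : Fin n → ℕ
  outdeg i = ∑[ j < n ] 𝟙 (arc G i j)

  numArcs≡∑outdeg : numArcs G ≡ ∑[ i < n ] outdeg i
  numArcs≡∑outdeg = trans (sumᴸ-map-allFin λ i → ℕᴸ.sum (map (𝟙 ∘ arc G i) (allFin n)))
                          (sum-cong-≗ λ i → sumᴸ-map-allFin (𝟙 ∘ arc G i))

  out-neighbour : ∀ {i} → 0 < outdeg i → ∃[ j ] T (arc G i j)
  out-neighbour pos with ∑-pos⇒∃-pos _ pos
  ... | j , ij = j , 𝟙-pos⇒T ij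

  Big : Fin n → Set
  Big i = 2 ≤ outdeg i

  big? : ∀ i → Dec (Big i)
  big? i = 2 ≤? outdeg i

  out-neighbour-≢ : ∀ {i} → Big i → ∀ j → ∃[ k ] k ≢ j × T (arc G i k)
  out-neighbour-≢ big j with ∃-other-pos _ (𝟙≤1 ∘ arc G _) big j
  ... | k , k≢j , ik = k , k≢j , 𝟙-pos⇒T ik

  ownArcs : Fin n → ℕ
  ownArcs i = if does (big? i) then 0 else outdeg i

  bigArc : Fin n → Fin n → ℕ
  bigArc i j = if does (big? i) then 𝟙 (arc G i j) else 0

  bigIndeg : Fin n → ℕ
  bigIndeg j = ∑[ i < n ] bigArc i j

  weight : Fin n → ℕ
  weight v = ownArcs v + bigIndeg v

  outdeg≡ownArcs+∑bigArc : ∀ i → outdeg i ≡ ownArcs i + ∑[ j < n ] bigArc i j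
  outdeg≡ownArcs+∑bigArc i = split (does (big? i))
    where
    split : ∀ b → outdeg i ≡ (if b then 0 else outdeg i) + ∑[ j < n ] (if b then 𝟙 (arc G i j) else 0)
    split true  = refl
    split false = sym (trans (cong (outdeg i +_) (∑-zero n)) (+-identityʳ (outdeg i)))

  numArcs≡∑weight : numArcs G ≡ ∑[ v < n ] weight v
  numArcs≡∑weight = begin-equality
    numArcs G                                                    ≡⟨ numArcs≡∑outdeg ⟩
    ∑[ i < n ] outdeg i                                          ≡⟨ sum-cong-≗ outdeg≡ownArcs+∑bigArc ⟩
    ∑[ i < n ] (ownArcs i + ∑[ j < n ] bigArc i j)               ≡⟨ ∑-distrib-+ ownArcs _ ⟩
    ∑[ i < n ] ownArcs i + ∑[ i < n ] ∑[ j < n ] bigArc i j      ≡⟨ cong (sum ownArcs +_) (∑-comm bigArc) ⟩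
    ∑[ i < n ] ownArcs i + ∑[ j < n ] bigIndeg j                 ≡⟨ ∑-distrib-+ ownArcs bigIndeg ⟨
    ∑[ v < n ] weight v                                          ∎

  ownArcs-big : ∀ {i} → Big i → ownArcs i ≡ 0
  ownArcs-big {i} big = if-cong (dec-true (big? i) big)

  ownArcs-small : ∀ {i} → ¬ Big i → ownArcs i ≡ outdeg i
  ownArcs-small {i} small = if-cong (dec-false (big? i) small)

  bigArc-big : ∀ {i j} → Big i → bigArc i j ≡ 𝟙 (arc G i j)
  bigArc-big {i} big = if-cong (dec-true (big? i) big)

  bigArc-small : ∀ {i j} → ¬ Big i → bigArc i j ≡ 0
  bigArc-small {i} small = if-cong (dec-false (big? i) small)

  ownArcs≤1 : ∀ i → ownArcs i ≤ 1
  ownArcs≤1 i with big? i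
  ... | yes big  = subst (_≤ 1) (sym (ownArcs-big big)) z≤n
  ... | no small = subst (_≤ 1) (sym (ownArcs-small small)) (s≤s⁻¹ (≰⇒> small))

  ownArcs-pos : ∀ {i} → 0 < ownArcs i → ¬ Big i × 0 < outdeg i
  ownArcs-pos {i} pos with big? i
  ... | yes big  = contradiction (subst (0 <_) (ownArcs-big big) pos) n≮0
  ... | no small = small , subst (0 <_) (ownArcs-small small) pos

  bigArc≤1 : ∀ i j → bigArc i j ≤ 1
  bigArc≤1 i j = if≤1 (does (big? i))
    where
    if≤1 : ∀ b → (if b then 𝟙 (arc G i j) else 0) ≤ 1
    if≤1 true  = 𝟙≤1 (arc G i j)
    if≤1 false = z≤n

  bigArc-pos : ∀ {i j} → 0 < bigArc i j → Big i × T (arc G i j)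
  bigArc-pos {i} pos with big? i
  ... | yes big  = big , 𝟙-pos⇒T (subst (0 <_) (bigArc-big big) pos)
  ... | no small = contradiction (subst (0 <_) (bigArc-small small) pos) n≮0

  big-in-neighbour : ∀ {j} → 0 < bigIndeg j → ∃[ i ] Big i × T (arc G i j)
  big-in-neighbour pos with ∑-pos⇒∃-pos _ pos
  ... | i , ij = i , bigArc-pos ij

  module _ (oriented : IsOriented G) (free : ¬ ContainsAP4 G) where
    open IsOriented oriented

    arc⇒≢ : ∀ {x y} → T (arc G x y) → x ≢ y
    arc⇒≢ {x} xy refl = noLoop x xy

    path⇒≢ : ∀ {x y z} → T (arc G x y) → T (arc G y z) → x ≢ z
    path⇒≢ {x} {y} xy yx refl = noOpposite x y xy yx

    common-out-neighbour⇒arc : ∀ {c c' j} → Big c → T (arc G c j) → T (arc G c' j) → c' ≢ c →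
                               T (arc G c c')
    common-out-neighbour⇒arc {c} {c'} {j} big cj c'j c'≢c with out-neighbour-≢ big j
    ... | d , d≢j , cd with d ≟ᶠ c'
    ...   | yes refl = cd
    ...   | no d≢c'  = ⊥-elim (free (c' , j , c , d ,
              arc⇒≢ c'j , c'≢c , ≢-sym d≢c' , ≢-sym (arc⇒≢ cj) , ≢-sym d≢j , arc⇒≢ cd ,
              c'j , cj , cd))

    bigIndeg≤1 : ∀ j → bigIndeg j ≤ 1
    bigIndeg≤1 j = ∑-≤1 (λ i → bigArc i j) (λ i → bigArc≤1 i j) unique
      where
      unique : ∀ i i' → 0 < bigArc i j → 0 < bigArc i' j → i ≡ i'
      unique i i' ij i'j with i ≟ᶠ i' | bigArc-pos ij | bigArc-pos i'j
      ... | yes i≡i' | _ | _ = i≡i'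
      ... | no i≢i' | big , ij | big' , i'j = ⊥-elim (noOpposite i i'
              (common-out-neighbour⇒arc big ij i'j (≢-sym i≢i'))
              (common-out-neighbour⇒arc big' i'j ij i≢i'))

    weight≤2 : ∀ v → weight v ≤ 2
    weight≤2 v = +-mono-≤ (ownArcs≤1 v) (bigIndeg≤1 v)

    weight-big≤1 : ∀ {v} → Big v → weight v ≤ 1
    weight-big≤1 {v} big = subst (λ x → x + bigIndeg v ≤ 1) (sym (ownArcs-big big)) (bigIndeg≤1 v)

    ¬dominating-vertex : ∀ {c b} → T (arc G c b) →
                         (∀ v → v ≢ c → T (arc G c v) × ∃[ x ] T (arc G v x)) → ⊥
    ¬dominating-vertex {c} {b} cb dominating with dominating b (≢-sym (arc⇒≢ cb))
    ... | _ , x , bx with dominating x (path⇒≢ cb bx ∘ sym)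
    ...   | cx , y , xy with dominating y (path⇒≢ cx xy ∘ sym)
    ...     | cy , _ = free (b , x , c , y ,
                arc⇒≢ bx , ≢-sym (arc⇒≢ cb) , path⇒≢ bx xy , path⇒≢ cb bx ∘ sym ,
                arc⇒≢ xy , arc⇒≢ cy , bx , cx , cy)

    slack-no-big : (∀ i → ¬ Big i) → n ≤ ∑[ v < n ] (2 ∸ weight v)
    slack-no-big small = slack-all weight weight≤1
      where
      weight≤1 : ∀ v → weight v ≤ 1
      weight≤1 v = begin
        ownArcs v + bigIndeg v    ≡⟨ cong (ownArcs v +_) (sum-cong-≗ λ i → bigArc-small (small i)) ⟩
        ownArcs v + ∑[ i < n ] 0  ≡⟨ cong (ownArcs v +_) (∑-zero n) ⟩
        ownArcs v + 0             ≡⟨ +-identityʳ (ownArcs v) ⟩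
        ownArcs v                 ≤⟨ ownArcs≤1 v ⟩
        1                         ∎

    slack-big-in-neighbour : ∀ {c} → Big c → 0 < bigIndeg c → 3 ≤ ∑[ v < n ] (2 ∸ weight v)
    slack-big-in-neighbour {c} big-c in>0 with big-in-neighbour in>0
    ... | p , big-p , pc with 0 <? bigIndeg p
    ...   | no ¬in>0 = slack-pair weight (arc⇒≢ pc)
                         (cong₂ _+_ (ownArcs-big big-p) (≯0⇒≡0 ¬in>0)) (weight-big≤1 big-c)
    ...   | yes pin>0 with big-in-neighbour pin>0
    ...     | q , big-q , qp = slack-triple weight
                                 (≢-sym (arc⇒≢ pc)) (≢-sym (path⇒≢ qp pc)) (≢-sym (arc⇒≢ qp))
                                 (weight-big≤1 big-c) (weight-big≤1 big-p) (weight-big≤1 big-q)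

    slack-big-source : ∀ {c} → Big c → bigIndeg c ≡ 0 → 3 ≤ ∑[ v < n ] (2 ∸ weight v)
    slack-big-source {c} big-c no-in with any? (λ v → ¬? (v ≟ᶠ c) ×-dec (weight v ≤? 1))
    ... | yes (v , v≢c , wᵥ≤1) =
      slack-pair weight (≢-sym v≢c) (cong₂ _+_ (ownArcs-big big-c) no-in) wᵥ≤1
    ... | no none =
      ⊥-elim (¬dominating-vertex (proj₂ (out-neighbour (≤-trans (s≤s z≤n) big-c))) dominating)
      where
      full : ∀ v → v ≢ c → 0 < ownArcs v × 0 < bigIndeg v
      full v v≢c = both-pos (ownArcs≤1 v) (bigIndeg≤1 v) (≰⇒> λ wᵥ≤1 → none (v , v≢c , wᵥ≤1))

      dominating : ∀ v → v ≢ c → T (arc G c v) × ∃[ x ] T (arc G v x)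
      dominating v v≢c with full v v≢c
      ... | own>0 , in>0 with big-in-neighbour in>0 | ownArcs-pos own>0
      ...   | p , big-p , pv | _ , out>0 with p ≟ᶠ c
      ...     | yes refl = pv , out-neighbour out>0
      ...     | no p≢c   = contradiction big-p (proj₁ (ownArcs-pos (proj₁ (full p p≢c))))

    slack : 3 ≤ n → 3 ≤ ∑[ v < n ] (2 ∸ weight v)
    slack n≥3 with any? big?
    ... | no none = ≤-trans n≥3 (slack-no-big λ i big → none (i , big))
    ... | yes (c , big-c) with 0 <? bigIndeg c
    ...   | yes in>0 = slack-big-in-neighbour big-c in>0
    ...   | no ¬in>0 = slack-big-source big-c (≯0⇒≡0 ¬in>0)

    numArcs≤2n∸3 : 3 ≤ n → numArcs G ≤ 2 * n ∸ 3
    numArcs≤2n∸3 n≥3 =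
      subst (_≤ 2 * n ∸ 3) (sym numArcs≡∑weight) (∑-≤-2n∸3 weight weight≤2 (slack n≥3))

numArcs≤1 : (G : Digraph 2) → IsOriented G → numArcs G ≤ 1
numArcs≤1 G oriented = subst (_≤ 1) (sym (numArcs≡∑outdeg G))
  (two-vertices (arc G zero zero) (arc G zero (suc zero))
                (arc G (suc zero) zero) (arc G (suc zero) (suc zero))
                (noLoop zero) (noLoop (suc zero)) (noOpposite zero (suc zero)))
  where
  open IsOriented oriented
  two-vertices : ∀ b₀₀ b₀₁ b₁₀ b₁₁ → ¬ T b₀₀ → ¬ T b₁₁ → (T b₀₁ → ¬ T b₁₀) →
                 (𝟙 b₀₀ + (𝟙 b₀₁ + 0)) + ((𝟙 b₁₀ + (𝟙 b₁₁ + 0)) + 0) ≤ 1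
  two-vertices true  _     _     _     ¬b₀₀ _    _  = contradiction tt ¬b₀₀
  two-vertices false _     _     true  _    ¬b₁₁ _  = contradiction tt ¬b₁₁
  two-vertices false true  true  false _    _    ¬2 = contradiction tt (¬2 tt)
  two-vertices false true  false false _    _    _  = s≤s z≤n
  two-vertices false false true  false _    _    _  = s≤s z≤n
  two-vertices false false false false _    _    _  = z≤n

-- The extremal graph

-- The only vertex with two in-neighbours is 0, and these in-neighbours have out-degree 1.
extremalArc : ∀ {m} → Fin (suc (suc m)) → Fin (suc (suc m)) → Bool
extremalArc zero          (suc zero)    = true
extremalArc (suc zero)    (suc (suc _)) = true
extremalArc (suc (suc _)) zero          = true
extremalArc _             _             = false

extremal : ∀ m → Digraph (suc (suc m))
extremal m = record { arc = extremalArc }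

extremal-oriented : ∀ m → IsOriented (extremal m)
extremal-oriented m = record { noLoop = noLoop ; noOpposite = noOpposite }
  where
  noLoop : ∀ i → ¬ T (extremalArc {m} i i)
  noLoop zero          ()
  noLoop (suc zero)    ()
  noLoop (suc (suc i)) ()
  noOpposite : ∀ i j → T (extremalArc {m} i j) → ¬ T (extremalArc j i)
  noOpposite zero          (suc zero)    _ ()
  noOpposite (suc zero)    (suc (suc _)) _ ()
  noOpposite (suc (suc _)) zero          _ ()

extremal-free : ∀ m → ¬ ContainsAP4 (extremal m)
extremal-free m (a , b , c , d , _ , a≢c , _ , _ , b≢d , _ , ab , cb , cd) =
  go a b c d a≢c b≢d ab cb cd
  where
  go : ∀ a b c d → a ≢ c → b ≢ d →
       T (extremalArc {m} a b) → T (extremalArc c b) → T (extremalArc c d) → ⊥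
  go zero          (suc zero)    zero          _    a≢c _   _ _  _ = a≢c refl
  go (suc zero)    (suc (suc _)) (suc zero)    _    a≢c _   _ _  _ = a≢c refl
  go (suc (suc _)) zero          (suc (suc _)) zero _   b≢d _ _  _ = b≢d refl
  go zero          (suc zero)    (suc zero)    _    _   _   _ () _
  go zero          (suc zero)    (suc (suc _)) _    _   _   _ () _

extremal-numArcs : ∀ m → numArcs (extremal m) ≡ 2 * suc (suc m) ∸ 3
extremal-numArcs m = begin-equality
  numArcs (extremal m)                          ≡⟨ numArcs≡∑outdeg (extremal m) ⟩
  ∑[ i < suc (suc m) ] outdeg (extremal m) i
    ≡⟨ cong₂ (λ x y → 1 + x + (y + ∑[ k < m ] (1 + x))) (∑-zero m) ∑1≡m ⟩
  1 + (m + ∑[ k < m ] 1)                        ≡⟨ cong (λ y → 1 + (m + y)) ∑1≡m ⟩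
  1 + (m + m)                                   ≡⟨ 2[m+2]∸3≡1+2m ⟨
  2 * suc (suc m) ∸ 3                           ∎
  where
  ∑1≡m : ∑[ k < m ] 1 ≡ m
  ∑1≡m = trans (∑-const m 1) (*-identityʳ m)
  2[m+2]∸3≡1+2m : 2 * suc (suc m) ∸ 3 ≡ 1 + (m + m)
  2[m+2]∸3≡1+2m rewrite +-identityʳ m | +-suc m (suc m) | +-suc m m = refl

proposition2p6 : ∀ (n : ℕ) → 1 < n → IsExOriAP4 n (2 * n ∸ 3)
proposition2p6 (suc zero) (s≤s ())
proposition2p6 (suc (suc m)) _ =
  (extremal m , extremal-oriented m , extremal-free m , extremal-numArcs m) , upper m
  where
  upper : ∀ m (G : Digraph (suc (suc m))) → IsOriented G → ¬ ContainsAP4 G →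
          numArcs G ≤ 2 * suc (suc m) ∸ 3
  upper zero    G oriented _    = numArcs≤1 G oriented
  upper (suc _) G oriented free = numArcs≤2n∸3 G oriented free (s≤s (s≤s (s≤s z≤n)))
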